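{- Let $k$ be a positive integer, $w$ a permutation, and $m_1,m_2$ positive integers. Suppose $u_1,u_2\dashv h_{m_1}\mathfrak{S}_w(x_1,\dots,x_k)$ are equivalent permutations with $u_1\neq u_2$. Then there is no permutation $u'$ with both $u'\dashv h_{m_2}\mathfrak{S}_{u_1}(x_1,\dots,x_k)$ and $u'\dashv h_{m_2}\mathfrak{S}_{u_2}(x_1,\dots,x_k)$.
   Context: $\mathfrak{S}_w$ is the Schubert polynomial of $w$ (permutations of $S_N$ are viewed in larger symmetric groups by fixing larger integers), $h_m(x_1,\dots,x_k)$ is the complete homogeneous symmetric polynomial of degree $m$ in $k$ variables, $t_{ab}$ is the transposition of positions $a,b$ (so $wt_{ab}$ swaps the values in positions $a$ and $b$) and $\ell$ is Coxeter length. By Sottile's Pieri rule, $\mathfrak{S}_w h_m(x_1,\dots,x_k)=\sum_v \mathfrak{S}_v$, summed over all $v=wt_{a_1b_1}\cdots t_{a_mb_m}$ with $a_i\le k<b_i$, $a_1\le a_2\le\dots\le a_m$, $b_1,\dots,b_m$ distinct, and $\ell(wt_{a_1b_1}\cdots t_{a_ib_i})=\ell(w)+i$ for $1\le i\le m$. We write $u\dashv h_m\mathfrak{S}_w(x_1,\dots,x_k)$ if $\mathfrak{S}_u$ is a term of this sum. Two permutations $u_1,u_2\dashv h_m\mathfrak{S}_w$ are called equivalent if they admit such expressions $u_i=wt_{a_{i1}b_{i1}}\cdots t_{a_{im}b_{im}}$ ($i=1,2$) with $b_{1j}=b_{2j}$ for all $1\le j\le m$, each value appearing in a consecutive block of each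 sequence $(a_{i1},\dots,a_{im})$, and for every $1\le j<m$: $a_{1j}=a_{1,j+1}$ if and only if $a_{2j}=a_{2,j+1}$. -}

module Defs where

open import Data.Nat using (ℕ; zero; suc; _<_; _≤_; _<?_)
open import Data.Fin as Fin using (Fin; toℕ)
open import Data.Fin.Properties using (_≟_)
open import Data.Vec as Vec using (Vec; lookup; _[_]≔_; toList)
open import Data.List as List using (List; []; _∷_; map; filter; cartesianProduct; allFin; length; applyUpTo)
open import Data.List.Relation.Unary.All using (All)
open import Data.List.Relation.Unary.Linked using (Linked)
open import Data.List.Relation.Unary.Unique.Propositional using (Unique)
open import Data.List.Relation.Binary.Permutation.Propositional using (_↭_)
open import Data.Product using (Σ; _×_; _,_; proj₁; proj₂; ∃)
open import Data.Unit using (⊤)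
open import Relation.Binary.PropositionalEquality using (_≡_)
open import Relation.Nullary.Decidable using (_×-dec_)
open import Function.Bundles using (_⇔_)

-- Permutations of S_N in one-line notation: w = [w(1), ..., w(N)], values in {1..N}.
-- Position p (1-based) corresponds to i : Fin N with p = toℕ i + 1.
OneLine : ℕ → Set
OneLine N = Vec ℕ N

IsPerm : ∀ {N} → OneLine N → Set
IsPerm {N} w = toList w ↭ applyUpTo suc N

len : ∀ {N} → OneLine N → ℕ
len {N} w = length (filter (λ p → (toℕ (proj₁ p) <? toℕ (proj₂ p))
                                ×-dec (lookup w (proj₂ p) <? lookup w (proj₁ p)))
                           (cartesianProduct (allFin N) (allFin N)))

-- w t_{ab}: swap the values in positions a and b.
swapPos : ∀ {N} → OneLine N → Fin N → Fin N → OneLine N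
swapPos w a b = (w [ a ]≔ lookup w b) [ b ]≔ lookup w a

applyTs : ∀ {N} → OneLine N → List (Fin N × Fin N) → OneLine N
applyTs w [] = w
applyTs w ((a , b) ∷ ts) = applyTs (swapPos w a b) ts

-- a ≤ k < b for 1-based positions
Straddles : ∀ {N} → ℕ → Fin N × Fin N → Set
Straddles k (a , b) = (suc (toℕ a) ≤ k) × (k < suc (toℕ b))

LenInc : ∀ {N} → OneLine N → List (Fin N × Fin N) → Set
LenInc w [] = ⊤
LenInc w ((a , b) ∷ ts) = (len (swapPos w a b) ≡ suc (len w)) × LenInc (swapPos w a b) ts

_≤F_ : ∀ {N} → Fin N → Fin N → Set
a ≤F b = toℕ a ≤ toℕ b

PieriChain : ∀ {N} → ℕ → ℕ → OneLine N → List (Fin N × Fin N) → Set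
PieriChain {N} k m w ts =
  (length ts ≡ m) × All (Straddles k) ts × Linked _≤F_ (map proj₁ ts)
  × Unique (map proj₂ ts) × LenInc w ts

PieriTerm : ∀ {N} → ℕ → ℕ → OneLine N → OneLine N → Set
PieriTerm {N} k m w u = Σ (List (Fin N × Fin N)) λ ts → PieriChain k m w ts × (applyTs w ts ≡ u)

Consecutive : ∀ {N} → List (Fin N) → Set
Consecutive xs = ∀ (i j l : Fin (length xs)) → toℕ i < toℕ j → toℕ j < toℕ l →
  List.lookup xs i ≡ List.lookup xs l → List.lookup xs j ≡ List.lookup xs i

SamePattern : ∀ {N} → List (Fin N) → List (Fin N) → Set
SamePattern (x ∷ y ∷ xs) (x' ∷ y' ∷ ys) = ((x ≡ y) ⇔ (x' ≡ y')) × SamePattern (y ∷ xs) (y' ∷ ys)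
SamePattern _ _ = ⊤

Equivalent : ∀ {N} → ℕ → ℕ → OneLine N → OneLine N → OneLine N → Set
Equivalent {N} k m w u₁ u₂ =
  Σ (List (Fin N × Fin N)) λ ts₁ → Σ (List (Fin N × Fin N)) λ ts₂ →
    PieriChain k m w ts₁ × (applyTs w ts₁ ≡ u₁)
    × PieriChain k m w ts₂ × (applyTs w ts₂ ≡ u₂)
    × (map proj₂ ts₁ ≡ map proj₂ ts₂)
    × Consecutive (map proj₁ ts₁) × Consecutive (map proj₁ ts₂)
    × SamePattern (map proj₁ ts₁) (map proj₁ ts₂)

-- Along a Pieri chain for h_m(x_1, …, x_k) every step (a , b) has a ≤ k < b, so the values in
-- positions ≤ k only grow. A step adds exactly one inversion, which forces s a < s b with no
-- position strictly between a and b carrying a value strictly between s a and s b (the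
-- inversions of s inject into those of s t_ab, missing (a , b) and every such (a , q)). Hence if
-- p < q ≤ k and v p < v q, a chain from v never lifts the value at p to v q: a step at p brings in
-- some v b, and v b > v q would put q in between. So no permutation is reached both from u and
-- from v as soon as v p < v q ≤ u p.
--
-- Two distinct equivalent terms u₁, u₂ of h_m S_w give such positions. Their chains agree up to
-- the first step whose positions differ, say a₁ < a₂ from a common c. Both chains then leave at
-- their first position the value c had at the b closing the first run of equal positions, a run
-- of the same length in both chains; so u₁ a₁ = u₂ a₂. Meanwhile u₂ never touches a₁, and
-- u₂ a₁ = c a₁ < c b ≤ u₁ a₁.

module Submission where

open import Defs
open import Data.Empty using (⊥; ⊥-elim)
open import Data.Fin using (Fin; toℕ; zero; suc) renaming (_<_ to _<ᶠ_)
open import Data.Fin.Permutation.Components using (transpose)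
open import Data.Fin.Properties using (_≟_; <⇒≢; ≤∧≢⇒<) renaming (<-cmp to <ᶠ-cmp)
open import Data.List using (List; []; _∷_; _++_; map; filter; cartesianProduct; allFin; length)
open import Data.List.Membership.Propositional using (_∈_; _∉_)
open import Data.List.Membership.Propositional.Properties
  using (∈-map⁻; ∈-++⁻; ∈-filter⁺; ∈-filter⁻; ∈-cartesianProduct⁺; ∈-allFin)
open import Data.List.Properties using (∷-injective; length-removeAt′; length-map; length-++)
open import Data.List.Relation.Binary.Permutation.Propositional using (↭-sym; ↭⇒↭ₛ)
open import Data.List.Relation.Binary.Subset.Propositional using (_⊆_)
open import Data.List.Relation.Unary.All as All using (All; []; _∷_)
open import Data.List.Relation.Unary.All.Properties as All using ()
open import Data.List.Relation.Unary.Any using (here; there; index; _─_)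
open import Data.List.Relation.Unary.Linked as Linked using (Linked; [-]; _∷_)
open import Data.List.Relation.Unary.Unique.Propositional using (Unique; []; _∷_)
open import Data.List.Relation.Unary.Unique.Propositional.Properties as Unique
  using (allFin⁺; cartesianProduct⁺)
open import Data.Nat using (ℕ; suc; _+_; _<_; _≤_; _<?_; z≤n; s≤s; s≤s⁻¹)
open import Data.Nat.Properties
  using (≤-refl; ≤-trans; ≤-reflexive; <-trans; <-asym; <-irrefl; <⇒≤; <-≤-trans; n≤1+n; <-cmp;
         suc-injective; module ≤-Reasoning)
  renaming (<⇒≢ to <⇒≢ℕ)
open import Data.Product using (_×_; _,_; proj₁; proj₂; ∃₂)
open import Data.Sum using (_⊎_; inj₁; inj₂; [_,_]′)
open import Data.Unit using (tt)
open import Data.Vec using (_∷_; lookup; _[_]≔_; toList)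
open import Data.Vec.Membership.Propositional.Properties using (∈-lookup; ∈-toList⁺)
open import Data.Vec.Properties using (lookup∘update; lookup∘update′)
open import Function using (_∘_)
open import Function.Bundles using (Equivalence)
open import Function.Definitions using (Injective)
open import Relation.Binary.Definitions using (tri<; tri≈; tri>)
open import Relation.Binary.PropositionalEquality
  using (_≡_; _≢_; refl; sym; trans; cong; cong₂; subst; subst₂; ≢-sym; setoid; module ≡-Reasoning)
open import Data.List.Relation.Binary.Permutation.Setoid.Properties (setoid ℕ) using (Unique-resp-↭)
open import Relation.Nullary using (¬_; Dec; yes; no)
open import Relation.Nullary.Decidable using (dec-true; dec-false; _×-dec_)
open import Relation.Unary using (Decidable)

private variable N k m₁ m₂ : ℕ

transpose-left : (a b : Fin N) → transpose a b a ≡ b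
transpose-left a b rewrite dec-true (a ≟ a) refl = refl

transpose-right : (a b : Fin N) → transpose a b b ≡ a
transpose-right a b with b ≟ a
... | yes b≡a = b≡a
... | no _ rewrite dec-true (b ≟ b) refl = refl

transpose-other : {a b i : Fin N} → i ≢ a → i ≢ b → transpose a b i ≡ i
transpose-other {a = a} {b} {i} i≢a i≢b
  rewrite dec-false (i ≟ a) i≢a | dec-false (i ≟ b) i≢b = refl

transpose-involutive : (a b i : Fin N) → transpose a b (transpose a b i) ≡ i
transpose-involutive a b i = go (i ≟ a) (i ≟ b)
  where
  go : Dec (i ≡ a) → Dec (i ≡ b) → transpose a b (transpose a b i) ≡ i
  go (yes refl) _        = trans (cong (transpose i b) (transpose-left i b)) (transpose-right i b)
  go (no _) (yes refl)   = trans (cong (transpose a i) (transpose-right a i)) (transpose-left a i)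
  go (no i≢a) (no i≢b)  = trans (cong (transpose a b) (transpose-other i≢a i≢b)) (transpose-other i≢a i≢b)

lookup-swapPos : (s : OneLine N) (a b i : Fin N) → lookup (swapPos s a b) i ≡ lookup s (transpose a b i)
lookup-swapPos s a b i = go (i ≟ a) (i ≟ b)
  where
  go : Dec (i ≡ a) → Dec (i ≡ b) → lookup (swapPos s a b) i ≡ lookup s (transpose a b i)
  go _ (yes refl) = trans (lookup∘update i (s [ a ]≔ lookup s i) (lookup s a))
    (cong (lookup s) (sym (transpose-right a i)))
  go (yes refl) (no i≢b) = trans (lookup∘update′ i≢b (s [ i ]≔ lookup s b) (lookup s i))
    (trans (lookup∘update i s (lookup s b)) (cong (lookup s) (sym (transpose-left i b))))
  go (no i≢a) (no i≢b) = trans (lookup∘update′ i≢b (s [ a ]≔ lookup s b) (lookup s a))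
    (trans (lookup∘update′ i≢a s (lookup s b)) (cong (lookup s) (sym (transpose-other i≢a i≢b))))

lookup-swapPos-left : (s : OneLine N) (a b : Fin N) → lookup (swapPos s a b) a ≡ lookup s b
lookup-swapPos-left s a b = trans (lookup-swapPos s a b a) (cong (lookup s) (transpose-left a b))

lookup-swapPos-right : (s : OneLine N) (a b : Fin N) → lookup (swapPos s a b) b ≡ lookup s a
lookup-swapPos-right s a b = trans (lookup-swapPos s a b b) (cong (lookup s) (transpose-right a b))

lookup-swapPos-other : (s : OneLine N) {a b i : Fin N} → i ≢ a → i ≢ b →
                       lookup (swapPos s a b) i ≡ lookup s i
lookup-swapPos-other s {a} {b} {i} i≢a i≢b =
  trans (lookup-swapPos s a b i) (cong (lookup s) (transpose-other i≢a i≢b))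

Distinct : OneLine N → Set
Distinct s = Injective _≡_ _≡_ (lookup s)

swapPos-Distinct : (s : OneLine N) (a b : Fin N) → Distinct s → Distinct (swapPos s a b)
swapPos-Distinct s a b s-distinct {i} {j} si≡sj = begin
  i                                ≡⟨ transpose-involutive a b i ⟨
  transpose a b (transpose a b i)  ≡⟨ cong (transpose a b) (s-distinct (begin
    lookup s (transpose a b i)         ≡⟨ lookup-swapPos s a b i ⟨
    lookup (swapPos s a b) i           ≡⟨ si≡sj ⟩
    lookup (swapPos s a b) j           ≡⟨ lookup-swapPos s a b j ⟩
    lookup s (transpose a b j)         ∎)) ⟩
  transpose a b (transpose a b j)  ≡⟨ transpose-involutive a b j ⟩
  j                                ∎
  where open ≡-Reasoning

applyTs-Distinct : (s : OneLine N) (ts : List (Fin N × Fin N)) → Distinct s → Distinct (applyTs s ts)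
applyTs-Distinct s [] s-distinct = s-distinct
applyTs-Distinct s ((a , b) ∷ ts) s-distinct =
  applyTs-Distinct (swapPos s a b) ts (swapPos-Distinct s a b s-distinct)

Unique-toList⇒Distinct : (v : OneLine N) → Unique (toList v) → Distinct v
Unique-toList⇒Distinct (x ∷ xs) _ {zero} {zero} _ = refl
Unique-toList⇒Distinct (x ∷ xs) (x∉xs ∷ _) {zero} {suc j} x≡xsj =
  ⊥-elim (All.lookup x∉xs (∈-toList⁺ (∈-lookup j xs)) x≡xsj)
Unique-toList⇒Distinct (x ∷ xs) (x∉xs ∷ _) {suc i} {zero} xsi≡x =
  ⊥-elim (All.lookup x∉xs (∈-toList⁺ (∈-lookup i xs)) (sym xsi≡x))
Unique-toList⇒Distinct (x ∷ xs) (_ ∷ xs-unique) {suc i} {suc j} xsi≡xsj =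
  cong suc (Unique-toList⇒Distinct xs xs-unique xsi≡xsj)

IsPerm⇒Distinct : (w : OneLine N) → IsPerm w → Distinct w
IsPerm⇒Distinct {N} w w-perm = Unique-toList⇒Distinct w
  (Unique-resp-↭ (↭⇒↭ₛ (↭-sym w-perm)) (Unique.applyUpTo⁺₁ suc N λ i<j _ → <⇒≢ℕ i<j ∘ suc-injective))

module _ {A : Set} where

  ∈-─ : {x z : A} {xs : List A} (x∈xs : x ∈ xs) → z ∈ xs → z ≢ x → z ∈ (xs ─ x∈xs)
  ∈-─ (here refl)  (here refl)  z≢x = ⊥-elim (z≢x refl)
  ∈-─ (here refl)  (there z∈xs) _   = z∈xs
  ∈-─ (there _)    (here refl)  _   = here refl
  ∈-─ (there x∈xs) (there z∈xs) z≢x = there (∈-─ x∈xs z∈xs z≢x)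

  Unique⇒length≤ : {xs ys : List A} → Unique xs → xs ⊆ ys → length xs ≤ length ys
  Unique⇒length≤ {[]} _ _ = z≤n
  Unique⇒length≤ {x ∷ xs} {ys} (x∉xs ∷ xs-unique) xs⊆ys = begin
    suc (length xs)           ≤⟨ s≤s (Unique⇒length≤ xs-unique xs⊆ys─x) ⟩
    suc (length (ys ─ x∈ys))  ≡⟨ length-removeAt′ ys (index x∈ys) ⟨
    length ys                 ∎
    where
    open ≤-Reasoning
    x∈ys : x ∈ ys
    x∈ys = xs⊆ys (here refl)
    xs⊆ys─x : xs ⊆ (ys ─ x∈ys)
    xs⊆ys─x z∈xs = ∈-─ x∈ys (xs⊆ys (there z∈xs)) (λ z≡x → All.lookup x∉xs z∈xs (sym z≡x))

  Unique-map⁺-on : {B : Set} (f : A → B) {xs : List A} → Unique xs →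
                   (∀ {x y} → x ∈ xs → y ∈ xs → f x ≡ f y → x ≡ y) → Unique (map f xs)
  Unique-map⁺-on f {[]} _ _ = []
  Unique-map⁺-on f {x ∷ xs} (x∉xs ∷ xs-unique) f-injective =
    All.map⁺ (All.tabulate λ y∈xs fx≡fy → All.lookup x∉xs y∈xs (f-injective (here refl) (there y∈xs) fx≡fy))
    ∷ Unique-map⁺-on f xs-unique (λ x∈xs y∈xs → f-injective (there x∈xs) (there y∈xs))

pairs : ∀ N → List (Fin N × Fin N)
pairs N = cartesianProduct (allFin N) (allFin N)

IsInversion : OneLine N → Fin N × Fin N → Set
IsInversion s p = toℕ (proj₁ p) < toℕ (proj₂ p) × lookup s (proj₂ p) < lookup s (proj₁ p)

inversion? : (s : OneLine N) → Decidable (IsInversion s)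
inversion? s p = (toℕ (proj₁ p) <? toℕ (proj₂ p)) ×-dec (lookup s (proj₂ p) <? lookup s (proj₁ p))

-- len s unfolds to length (inversions s), which the counting below relies on.
inversions : OneLine N → List (Fin N × Fin N)
inversions {N} s = filter (inversion? s) (pairs N)

inversions-Unique : (s : OneLine N) → Unique (inversions s)
inversions-Unique {N} s = Unique.filter⁺ (inversion? s) (cartesianProduct⁺ (allFin⁺ N) (allFin⁺ N))

∈-inversions⁺ : (s : OneLine N) {p : Fin N × Fin N} → IsInversion s p → p ∈ inversions s
∈-inversions⁺ s {i , j} = ∈-filter⁺ (inversion? s) (∈-cartesianProduct⁺ (∈-allFin i) (∈-allFin j))

∈-inversions⁻ : (s : OneLine N) {p : Fin N × Fin N} → p ∈ inversions s → IsInversion s p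
∈-inversions⁻ {N} s p∈ = proj₂ (∈-filter⁻ (inversion? s) {xs = pairs N} p∈)

-- s′ = s t_ab pointwise; unlike swapPos this relation is symmetric in s and s′.
Swapped : OneLine N → Fin N → Fin N → OneLine N → Set
Swapped {N} s a b s′ = ∀ i → lookup s′ i ≡ lookup s (transpose a b i)

Swapped-sym : (s s′ : OneLine N) {a b : Fin N} → Swapped s a b s′ → Swapped s′ a b s
Swapped-sym s s′ {a} {b} swapped i = begin
  lookup s i                                  ≡⟨ cong (lookup s) (transpose-involutive a b i) ⟨
  lookup s (transpose a b (transpose a b i))  ≡⟨ swapped (transpose a b i) ⟨
  lookup s′ (transpose a b i)                 ∎
  where open ≡-Reasoning

module SwapInversions {N} (s s′ : OneLine N) {a b : Fin N} (swapped : Swapped s a b s′)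
                      (a<b : a <ᶠ b) (sa<sb : lookup s a < lookup s b) where

  private
    t : Fin N → Fin N
    t = transpose a b

    t-injective : ∀ {i j} → t i ≡ t j → i ≡ j
    t-injective {i} {j} ti≡tj =
      trans (sym (transpose-involutive a b i)) (trans (cong t ti≡tj) (transpose-involutive a b j))

    s′-at : ∀ i j → t i ≡ j → lookup s′ i ≡ lookup s j
    s′-at i j ti≡j = trans (swapped i) (cong (lookup s) ti≡j)

    s′∘t : ∀ i → lookup s′ (t i) ≡ lookup s i
    s′∘t i = sym (Swapped-sym s s′ swapped i)

    order-reversed : ∀ {i j} → i <ᶠ j → ¬ (t i <ᶠ t j) → lookup s j < lookup s i →
                     lookup s (t j) < lookup s (t i)
    order-reversed {i} {j} i<j ti≮tj sj<si = go (i ≟ a) (i ≟ b) (j ≟ a) (j ≟ b)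
      where
      go : Dec (i ≡ a) → Dec (i ≡ b) → Dec (j ≡ a) → Dec (j ≡ b) → lookup s (t j) < lookup s (t i)
      go (yes refl) _ _ (yes refl) = ⊥-elim (<-asym sj<si sa<sb)
      go (yes refl) _ _ (no j≢b) = subst₂ _<_
        (cong (lookup s) (sym (transpose-other (λ j≡a → <⇒≢ i<j (sym j≡a)) j≢b)))
        (cong (lookup s) (sym (transpose-left a b))) (<-trans sj<si sa<sb)
      go (no i≢a) (yes refl) _ _ = ⊥-elim (ti≮tj (subst₂ _<ᶠ_ (sym (transpose-right a b))
        (sym (transpose-other (λ j≡a → <-asym a<b (subst (λ x → i <ᶠ x) j≡a i<j)) (λ j≡b → <⇒≢ i<j (sym j≡b))))
        (<-trans a<b i<j)))
      go (no i≢a) (no i≢b) (yes refl) _ = ⊥-elim (ti≮tj (subst₂ _<ᶠ_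
        (sym (transpose-other i≢a i≢b)) (sym (transpose-left a b)) (<-trans i<j a<b)))
      go (no i≢a) (no i≢b) (no _) (yes refl) = subst₂ _<_
        (cong (lookup s) (sym (transpose-right a b))) (cong (lookup s) (sym (transpose-other i≢a i≢b)))
        (<-trans sa<sb sj<si)
      go (no i≢a) (no i≢b) (no j≢a) (no j≢b) = ⊥-elim (ti≮tj (subst₂ _<ᶠ_
        (sym (transpose-other i≢a i≢b)) (sym (transpose-other j≢a j≢b)) i<j))

  -- The injection of inversions: a pair is moved by t when t keeps it ordered, and kept otherwise.
  τ : Fin N × Fin N → Fin N × Fin N
  τ (i , j) with toℕ (t i) <? toℕ (t j)
  ... | yes _ = t i , t j
  ... | no _  = i , j

  τ-inversion : ∀ {x} → IsInversion s x → IsInversion s′ (τ x)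
  τ-inversion {i , j} (i<j , sj<si) with toℕ (t i) <? toℕ (t j)
  ... | yes ti<tj = ti<tj , subst₂ _<_ (sym (s′∘t j)) (sym (s′∘t i)) sj<si
  ... | no ti≮tj  = i<j , subst₂ _<_ (sym (swapped j)) (sym (swapped i)) (order-reversed i<j ti≮tj sj<si)

  τ-injective : ∀ {x y} → proj₁ x <ᶠ proj₂ x → proj₁ y <ᶠ proj₂ y → τ x ≡ τ y → x ≡ y
  τ-injective {i , j} {i′ , j′} i<j i′<j′ τx≡τy
    with toℕ (t i) <? toℕ (t j) | toℕ (t i′) <? toℕ (t j′)
  ... | yes _ | yes _ = cong₂ _,_ (t-injective (cong proj₁ τx≡τy)) (t-injective (cong proj₂ τx≡τy))
  ... | no _  | no _  = τx≡τy
  ... | yes _ | no ti′≮tj′ =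
    ⊥-elim (ti′≮tj′ (subst₂ _<ᶠ_ (t-moves (cong proj₁ τx≡τy)) (t-moves (cong proj₂ τx≡τy)) i<j))
    where
    t-moves : ∀ {x y} → t x ≡ y → x ≡ t y
    t-moves {x} refl = sym (transpose-involutive a b x)
  ... | no ti≮tj | yes _ =
    ⊥-elim (ti≮tj (subst₂ _<ᶠ_ (t-moves (sym (cong proj₁ τx≡τy))) (t-moves (sym (cong proj₂ τx≡τy))) i′<j′))
    where
    t-moves : ∀ {x y} → t x ≡ y → x ≡ t y
    t-moves {x} refl = sym (transpose-involutive a b x)

  -- q = b is allowed, so that this also covers the pair (a , b).
  τ-avoids : ∀ {q x} → a <ᶠ q → toℕ q ≤ toℕ b → lookup s a < lookup s q → IsInversion s x → τ x ≢ (a , q)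
  τ-avoids {q} {i , j} a<q q≤b sa<sq (i<j , sj<si) τx≡aq with toℕ (t i) <? toℕ (t j)
  ... | no _ = <-asym sa<sq (subst₂ _<_ (cong (lookup s ∘ proj₂) τx≡aq) (cong (lookup s ∘ proj₁) τx≡aq) sj<si)
  ... | yes _ = <-irrefl refl (<-≤-trans b<tq tq≤b)
    where
    b<tq : b <ᶠ t q
    b<tq = subst₂ _<ᶠ_
      (trans (sym (transpose-involutive a b i)) (trans (cong t (cong proj₁ τx≡aq)) (transpose-left a b)))
      (trans (sym (transpose-involutive a b j)) (cong t (cong proj₂ τx≡aq))) i<j
    tq≤b : toℕ (t q) ≤ toℕ b
    tq≤b with q ≟ b
    ... | yes refl = <⇒≤ (subst (_< toℕ b) (cong toℕ (sym (transpose-right a b))) a<b)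
    ... | no q≢b = subst (_≤ toℕ b) (cong toℕ (sym (transpose-other (λ q≡a → <⇒≢ a<q (sym q≡a)) q≢b))) q≤b

  ab-inversion : IsInversion s′ (a , b)
  ab-inversion = a<b , subst₂ _<_ (sym (s′-at b a (transpose-right a b))) (sym (s′-at a b (transpose-left a b))) sa<sb

  aq-inversion : ∀ {q} → a <ᶠ q → q <ᶠ b → lookup s q < lookup s b → IsInversion s′ (a , q)
  aq-inversion {q} a<q q<b sq<sb =
    a<q , subst₂ _<_ (sym (s′-at q q tq≡q)) (sym (s′-at a b (transpose-left a b))) sq<sb
    where
    tq≡q : t q ≡ q
    tq≡q = transpose-other (λ q≡a → <⇒≢ a<q (sym q≡a)) (<⇒≢ q<b)

  τ-image : List (Fin N × Fin N)
  τ-image = map τ (inversions s)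

  τ-image-Unique : Unique τ-image
  τ-image-Unique = Unique-map⁺-on τ (inversions-Unique s) λ x∈ y∈ →
    τ-injective (proj₁ (∈-inversions⁻ s x∈)) (proj₁ (∈-inversions⁻ s y∈))

  τ-image-⊆ : τ-image ⊆ inversions s′
  τ-image-⊆ y∈ with ∈-map⁻ τ y∈
  ... | x , x∈ , refl = ∈-inversions⁺ s′ (τ-inversion (∈-inversions⁻ s x∈))

  ∉-τ-image : ∀ {q} → a <ᶠ q → toℕ q ≤ toℕ b → lookup s a < lookup s q → (a , q) ∉ τ-image
  ∉-τ-image a<q q≤b sa<sq aq∈ with ∈-map⁻ τ aq∈
  ... | x , x∈ , aq≡τx = τ-avoids a<q q≤b sa<sq (∈-inversions⁻ s x∈) (sym aq≡τx)

  length+len≤len : ∀ {extra} → Unique extra → extra ⊆ inversions s′ → All (_∉ τ-image) extra →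
                   length extra + len s ≤ len s′
  length+len≤len {extra} extra-Unique extra-⊆ extra-new = begin
    length extra + len s           ≡⟨ cong (length extra +_) (length-map τ (inversions s)) ⟨
    length extra + length τ-image  ≡⟨ length-++ extra ⟨
    length (extra ++ τ-image)      ≤⟨ Unique⇒length≤ (Unique.++⁺ extra-Unique τ-image-Unique disjoint)
                                                      ([ extra-⊆ , τ-image-⊆ ]′ ∘ ∈-++⁻ extra) ⟩
    len s′                         ∎
    where
    open ≤-Reasoning
    disjoint : ∀ {x} → ¬ (x ∈ extra × x ∈ τ-image)
    disjoint (x∈extra , x∈τ-image) = All.lookup extra-new x∈extra x∈τ-image

  suc-len≤len : suc (len s) ≤ len s′
  suc-len≤len = length+len≤len ([] ∷ []) (λ { (here refl) → ∈-inversions⁺ s′ ab-inversion })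
    (∉-τ-image a<b ≤-refl sa<sb ∷ [])

  2+len≤len : ∀ {q} → a <ᶠ q → q <ᶠ b → lookup s a < lookup s q → lookup s q < lookup s b →
              2 + len s ≤ len s′
  2+len≤len {q} a<q q<b sa<sq sq<sb = length+len≤len
    (((λ aq≡ab → <⇒≢ q<b (cong proj₂ aq≡ab)) ∷ []) ∷ [] ∷ [])
    (λ { (here refl) → ∈-inversions⁺ s′ (aq-inversion a<q q<b sq<sb)
       ; (there (here refl)) → ∈-inversions⁺ s′ ab-inversion })
    (∉-τ-image a<q (<⇒≤ q<b) sa<sq ∷ ∉-τ-image a<b ≤-refl sa<sb ∷ [])

length-step⇒ascent : (s : OneLine N) {a b : Fin N} → Distinct s → a <ᶠ b →
                     len (swapPos s a b) ≡ suc (len s) → lookup s a < lookup s b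
length-step⇒ascent s {a} {b} s-distinct a<b len-step with <-cmp (lookup s a) (lookup s b)
... | tri< sa<sb _ _ = sa<sb
... | tri≈ _ sa≡sb _ = ⊥-elim (<⇒≢ a<b (s-distinct sa≡sb))
... | tri> _ _ sb<sa =
  ⊥-elim (<-irrefl refl (≤-trans (n≤1+n _) (subst (λ n → suc n ≤ len s) len-step shorter)))
  where
  shorter : suc (len (swapPos s a b)) ≤ len s
  shorter = SwapInversions.suc-len≤len (swapPos s a b) s
    (Swapped-sym s (swapPos s a b) (lookup-swapPos s a b)) a<b
    (subst₂ _<_ (sym (lookup-swapPos-left s a b)) (sym (lookup-swapPos-right s a b)) sb<sa)

length-step⇒no-intermediate : (s : OneLine N) {a q b : Fin N} → a <ᶠ q → q <ᶠ b →
  lookup s a < lookup s q → lookup s q < lookup s b → len (swapPos s a b) ≢ suc (len s)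
length-step⇒no-intermediate s {a} {q} {b} a<q q<b sa<sq sq<sb len-step = <-irrefl refl
  (subst (2 + len s ≤_) len-step
    (SwapInversions.2+len≤len s (swapPos s a b) (lookup-swapPos s a b) (<-trans a<q q<b) (<-trans sa<sq sq<sb)
                              a<q q<b sa<sq sq<sb))

length-step⇒value-below : (s : OneLine N) {a q b : Fin N} → Distinct s → a <ᶠ q → q <ᶠ b →
  lookup s a < lookup s q → len (swapPos s a b) ≡ suc (len s) → lookup s b < lookup s q
length-step⇒value-below s {q = q} {b} s-distinct a<q q<b sa<sq len-step with <-cmp (lookup s b) (lookup s q)
... | tri< sb<sq _ _ = sb<sq
... | tri≈ _ sb≡sq _ = ⊥-elim (<⇒≢ q<b (sym (s-distinct sb≡sq)))
... | tri> _ _ sq<sb = ⊥-elim (length-step⇒no-intermediate s a<q q<b sa<sq sq<sb len-step)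

<-Linked⇒All : {p a : Fin N} {as : List (Fin N)} → p <ᶠ a → Linked _≤F_ (a ∷ as) → All (p <ᶠ_) as
<-Linked⇒All p<a [-] = []
<-Linked⇒All p<a (a≤b ∷ linked) = <-≤-trans p<a a≤b ∷ <-Linked⇒All (<-≤-trans p<a a≤b) linked

straddle-k≤b : {x : Fin N × Fin N} → Straddles k x → k ≤ toℕ (proj₂ x)
straddle-k≤b {x = _ , _} (_ , k<1+b) = s≤s⁻¹ k<1+b

straddle-a<b : {a b : Fin N} → Straddles k (a , b) → a <ᶠ b
straddle-a<b (a<k , k<1+b) = <-≤-trans a<k (s≤s⁻¹ k<1+b)

below≢above : {p b : Fin N} → toℕ p < k → k ≤ toℕ b → p ≢ b
below≢above p<k k≤b refl = <-irrefl refl (<-≤-trans p<k k≤b)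

lookup-applyTs-frozen : (s : OneLine N) (ts : List (Fin N × Fin N)) {p : Fin N} → toℕ p < k →
  All (Straddles k) ts → All (p <ᶠ_) (map proj₁ ts) → lookup (applyTs s ts) p ≡ lookup s p
lookup-applyTs-frozen s [] _ _ _ = refl
lookup-applyTs-frozen s ((a , b) ∷ ts) {p} p<k (ab ∷ ts-straddle) (p<a ∷ p<ts) = begin
  lookup (applyTs (swapPos s a b) ts) p  ≡⟨ lookup-applyTs-frozen (swapPos s a b) ts p<k ts-straddle p<ts ⟩
  lookup (swapPos s a b) p
    ≡⟨ lookup-swapPos-other s (<⇒≢ p<a) (below≢above p<k (straddle-k≤b ab)) ⟩
  lookup s p                             ∎
  where open ≡-Reasoning

length-step-raises : (s : OneLine N) {a b p : Fin N} → Distinct s → toℕ p < k → Straddles k (a , b) →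
  len (swapPos s a b) ≡ suc (len s) → lookup s p ≤ lookup (swapPos s a b) p
length-step-raises s {a} {b} {p} s-distinct p<k ab len-step with p ≟ a
... | yes refl = subst (lookup s p ≤_) (sym (lookup-swapPos-left s p b))
                       (<⇒≤ (length-step⇒ascent s s-distinct (straddle-a<b ab) len-step))
... | no p≢a = ≤-reflexive (sym (lookup-swapPos-other s p≢a (below≢above p<k (straddle-k≤b ab))))

lookup-applyTs-mono : (s : OneLine N) (ts : List (Fin N × Fin N)) {p : Fin N} → Distinct s → toℕ p < k →
  All (Straddles k) ts → LenInc s ts → lookup s p ≤ lookup (applyTs s ts) p
lookup-applyTs-mono s [] _ _ _ _ = ≤-refl
lookup-applyTs-mono s ((a , b) ∷ ts) s-distinct p<k (ab ∷ ts-straddle) (len-step , ts-inc) =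
  ≤-trans (length-step-raises s s-distinct p<k ab len-step)
          (lookup-applyTs-mono (swapPos s a b) ts (swapPos-Distinct s a b s-distinct) p<k ts-straddle ts-inc)

lookup-applyTs-stays-below : (s : OneLine N) (ts : List (Fin N × Fin N)) {p q : Fin N} → Distinct s →
  p <ᶠ q → toℕ q < k → All (Straddles k) ts → Linked _≤F_ (map proj₁ ts) → LenInc s ts →
  lookup s p < lookup s q → lookup (applyTs s ts) p < lookup s q
lookup-applyTs-stays-below s [] _ _ _ _ _ _ sp<sq = sp<sq
lookup-applyTs-stays-below s ((a , b) ∷ ts) {p} {q} s-distinct p<q q<k (ab ∷ ts-straddle) linked
                           (len-step , ts-inc) sp<sq = go (a ≟ p) (a ≟ q)
  where
  s′ : OneLine _
  s′ = swapPos s a b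
  k≤b : _ ≤ toℕ b
  k≤b = straddle-k≤b ab
  p<k : toℕ p < _
  p<k = <-trans p<q q<k

  rest : lookup s′ p < lookup s′ q → lookup (applyTs s′ ts) p < lookup s′ q
  rest = lookup-applyTs-stays-below s′ ts (swapPos-Distinct s a b s-distinct) p<q q<k ts-straddle
                                    (Linked.tail linked) ts-inc

  s′q≡sq : q ≢ a → lookup s′ q ≡ lookup s q
  s′q≡sq q≢a = lookup-swapPos-other s q≢a (below≢above q<k k≤b)

  s′p≡sp : p ≢ a → lookup s′ p ≡ lookup s p
  s′p≡sp p≢a = lookup-swapPos-other s p≢a (below≢above p<k k≤b)

  go : Dec (a ≡ p) → Dec (a ≡ q) → lookup (applyTs s′ ts) p < lookup s q
  go (yes refl) _ = subst (lookup (applyTs s′ ts) p <_) (s′q≡sq q≢a)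
                          (rest (subst₂ _<_ (sym (lookup-swapPos-left s a b)) (sym (s′q≡sq q≢a)) sb<sq))
    where
    q≢a : q ≢ a
    q≢a q≡a = <⇒≢ p<q (sym q≡a)
    sb<sq : lookup s b < lookup s q
    sb<sq = length-step⇒value-below s s-distinct p<q (<-≤-trans q<k k≤b) sp<sq len-step
  go (no a≢p) (yes refl) = begin-strict
    lookup (applyTs s′ ts) p  ≡⟨ lookup-applyTs-frozen s′ ts p<k ts-straddle (<-Linked⇒All p<q linked) ⟩
    lookup s′ p               ≡⟨ s′p≡sp (a≢p ∘ sym) ⟩
    lookup s p                <⟨ sp<sq ⟩
    lookup s a                ∎
    where open ≤-Reasoning
  go (no a≢p) (no a≢q) = subst (lookup (applyTs s′ ts) p <_) (s′q≡sq (a≢q ∘ sym))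
                               (rest (subst₂ _<_ (sym (s′p≡sp (a≢p ∘ sym))) (sym (s′q≡sq (a≢q ∘ sym))) sp<sq))

Separates : ℕ → OneLine N → OneLine N → Set
Separates {N} k u v = ∃₂ λ (p q : Fin N) →
  p <ᶠ q × toℕ q < k × lookup v p < lookup v q × lookup v q ≤ lookup u p

Separates⇒¬common-term : {u v u′ : OneLine N} → Distinct u → Distinct v → Separates k u v →
                         PieriTerm k m₁ u u′ → PieriTerm k m₂ v u′ → ⊥
Separates⇒¬common-term {u = u} {v} u-distinct v-distinct (p , q , p<q , q<k , vp<vq , vq≤up)
  (ts , (_ , ts-straddle , _ , _ , ts-inc) , refl) (ts′ , (_ , ts′-straddle , ts′-linked , _ , ts′-inc) , v⇝u′) =
  <-irrefl refl (begin-strict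
    lookup (applyTs u ts) p   ≡⟨ cong (λ u′ → lookup u′ p) v⇝u′ ⟨
    lookup (applyTs v ts′) p
      <⟨ lookup-applyTs-stays-below v ts′ v-distinct p<q q<k ts′-straddle ts′-linked ts′-inc vp<vq ⟩
    lookup v q                ≤⟨ vq≤up ⟩
    lookup u p                ≤⟨ lookup-applyTs-mono u ts u-distinct (<-trans p<q q<k) ts-straddle ts-inc ⟩
    lookup (applyTs u ts) p   ∎)
  where open ≤-Reasoning

-- The b closing the run of steps at position a with which the chain (a , b) ∷ ts starts.
blockEnd : Fin N → Fin N → List (Fin N × Fin N) → Fin N
blockEnd a b [] = b
blockEnd a b ((c , d) ∷ ts) with a ≟ c
... | yes _ = blockEnd a d ts
... | no _  = b

blockEnd-All : {P : Fin N → Set} (a b : Fin N) (ts : List (Fin N × Fin N)) →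
               P b → All (P ∘ proj₂) ts → P (blockEnd a b ts)
blockEnd-All a b [] Pb _ = Pb
blockEnd-All a b ((c , d) ∷ ts) Pb (Pd ∷ Pts) with a ≟ c
... | yes _ = blockEnd-All a d ts Pd Pts
... | no _  = Pb

lookup-applyTs-blockEnd : (s : OneLine N) (a b : Fin N) (ts : List (Fin N × Fin N)) →
  All (Straddles k) ((a , b) ∷ ts) → Linked _≤F_ (a ∷ map proj₁ ts) → Unique (b ∷ map proj₂ ts) →
  lookup (applyTs s ((a , b) ∷ ts)) a ≡ lookup s (blockEnd a b ts)
lookup-applyTs-blockEnd s a b [] _ _ _ = lookup-swapPos-left s a b
lookup-applyTs-blockEnd {k = k} s a b ((c , d) ∷ ts) (ab ∷ cd ∷ ts-straddle) (a≤c ∷ linked) (b∉ds ∷ ds-unique)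
  with a ≟ c
... | yes refl = begin
  lookup (applyTs (swapPos s a b) ((a , d) ∷ ts)) a
    ≡⟨ lookup-applyTs-blockEnd (swapPos s a b) a d ts (cd ∷ ts-straddle) linked ds-unique ⟩
  lookup (swapPos s a b) (blockEnd a d ts)  ≡⟨ lookup-swapPos-other s end≢a end≢b ⟩
  lookup s (blockEnd a d ts)                ∎
  where
  open ≡-Reasoning
  end≢a : blockEnd a d ts ≢ a
  end≢a = ≢-sym (below≢above (proj₁ ab)
    (blockEnd-All {P = λ e → k ≤ toℕ e} a d ts (straddle-k≤b cd) (All.map straddle-k≤b ts-straddle)))
  end≢b : blockEnd a d ts ≢ b
  end≢b = ≢-sym (blockEnd-All {P = b ≢_} a d ts (All.head b∉ds) (All.map⁻ (All.tail b∉ds)))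
... | no a≢c = begin
  lookup (applyTs (swapPos s a b) ((c , d) ∷ ts)) a
    ≡⟨ lookup-applyTs-frozen (swapPos s a b) ((c , d) ∷ ts) (proj₁ ab) (cd ∷ ts-straddle)
                             (a<c ∷ <-Linked⇒All a<c linked) ⟩
  lookup (swapPos s a b) a  ≡⟨ lookup-swapPos-left s a b ⟩
  lookup s b                ∎
  where
  open ≡-Reasoning
  a<c : a <ᶠ c
  a<c = ≤∧≢⇒< a≤c a≢c

blockEnd-SamePattern : (a₁ a₂ b : Fin N) (ts₁ ts₂ : List (Fin N × Fin N)) → map proj₂ ts₁ ≡ map proj₂ ts₂ →
  SamePattern (a₁ ∷ map proj₁ ts₁) (a₂ ∷ map proj₁ ts₂) → blockEnd a₁ b ts₁ ≡ blockEnd a₂ b ts₂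
blockEnd-SamePattern a₁ a₂ b [] [] _ _ = refl
blockEnd-SamePattern a₁ a₂ b ((c₁ , d) ∷ ts₁) ((c₂ , _) ∷ ts₂) d∷ds≡ (a₁≡c₁⇔a₂≡c₂ , same-pattern)
  with ∷-injective d∷ds≡
... | refl , ds≡ with a₁ ≟ c₁ | a₂ ≟ c₂
... | yes refl  | yes refl  = blockEnd-SamePattern a₁ a₂ d ts₁ ts₂ ds≡ same-pattern
... | no _      | no _      = refl
... | yes a₁≡c₁ | no a₂≢c₂ = ⊥-elim (a₂≢c₂ (Equivalence.to a₁≡c₁⇔a₂≡c₂ a₁≡c₁))
... | no a₁≢c₁  | yes a₂≡c₂ = ⊥-elim (a₁≢c₁ (Equivalence.from a₁≡c₁⇔a₂≡c₂ a₂≡c₂))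

first-values-agree : (c : OneLine N) (a₁ a₂ b : Fin N) (ts₁ ts₂ : List (Fin N × Fin N)) →
  PieriChain k m₁ c ((a₁ , b) ∷ ts₁) → PieriChain k m₂ c ((a₂ , b) ∷ ts₂) →
  map proj₂ ts₁ ≡ map proj₂ ts₂ → SamePattern (a₁ ∷ map proj₁ ts₁) (a₂ ∷ map proj₁ ts₂) →
  lookup (applyTs c ((a₁ , b) ∷ ts₁)) a₁ ≡ lookup (applyTs c ((a₂ , b) ∷ ts₂)) a₂
first-values-agree c a₁ a₂ b ts₁ ts₂
  (_ , straddle₁ , linked₁ , unique₁ , _) (_ , straddle₂ , linked₂ , unique₂ , _) ds≡ same-pattern = begin
  lookup (applyTs c ((a₁ , b) ∷ ts₁)) a₁  ≡⟨ lookup-applyTs-blockEnd c a₁ b ts₁ straddle₁ linked₁ unique₁ ⟩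
  lookup c (blockEnd a₁ b ts₁)
    ≡⟨ cong (lookup c) (blockEnd-SamePattern a₁ a₂ b ts₁ ts₂ ds≡ same-pattern) ⟩
  lookup c (blockEnd a₂ b ts₂)            ≡⟨ lookup-applyTs-blockEnd c a₂ b ts₂ straddle₂ linked₂ unique₂ ⟨
  lookup (applyTs c ((a₂ , b) ∷ ts₂)) a₂  ∎
  where open ≡-Reasoning

first-difference-Separates : (c : OneLine N) {a₁ a₂ b : Fin N} (ts₁ ts₂ : List (Fin N × Fin N)) → Distinct c →
  PieriChain k m₁ c ((a₁ , b) ∷ ts₁) → PieriChain k m₂ c ((a₂ , b) ∷ ts₂) → a₁ <ᶠ a₂ →
  lookup (applyTs c ((a₁ , b) ∷ ts₁)) a₁ ≡ lookup (applyTs c ((a₂ , b) ∷ ts₂)) a₂ →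
  Separates k (applyTs c ((a₁ , b) ∷ ts₁)) (applyTs c ((a₂ , b) ∷ ts₂))
first-difference-Separates c {a₁} {a₂} {b} ts₁ ts₂ c-distinct
  (_ , a₁b ∷ straddle₁ , _ , _ , len-step , inc₁) (_ , straddle₂@(a₂b ∷ _) , linked₂ , _) a₁<a₂ u₁a₁≡u₂a₂ =
  a₁ , a₂ , a₁<a₂ , proj₁ a₂b , u₂a₁<u₂a₂ , ≤-reflexive (sym u₁a₁≡u₂a₂)
  where
  u₂a₁<u₂a₂ : lookup (applyTs c ((a₂ , b) ∷ ts₂)) a₁ < lookup (applyTs c ((a₂ , b) ∷ ts₂)) a₂
  u₂a₁<u₂a₂ = begin-strict
    lookup (applyTs c ((a₂ , b) ∷ ts₂)) a₁
      ≡⟨ lookup-applyTs-frozen c ((a₂ , b) ∷ ts₂) (proj₁ a₁b) straddle₂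
                               (a₁<a₂ ∷ <-Linked⇒All a₁<a₂ linked₂) ⟩
    lookup c a₁                 <⟨ length-step⇒ascent c c-distinct (straddle-a<b a₁b) len-step ⟩
    lookup c b                  ≡⟨ lookup-swapPos-left c a₁ b ⟨
    lookup (swapPos c a₁ b) a₁
      ≤⟨ lookup-applyTs-mono (swapPos c a₁ b) ts₁ (swapPos-Distinct c a₁ b c-distinct)
                             (proj₁ a₁b) straddle₁ inc₁ ⟩
    lookup (applyTs c ((a₁ , b) ∷ ts₁)) a₁  ≡⟨ u₁a₁≡u₂a₂ ⟩
    lookup (applyTs c ((a₂ , b) ∷ ts₂)) a₂  ∎
    where open ≤-Reasoning

PieriChain-tail : {s : OneLine N} {a b : Fin N} {ts : List (Fin N × Fin N)} →
  PieriChain k m₁ s ((a , b) ∷ ts) → PieriChain k (length ts) (swapPos s a b) ts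
PieriChain-tail (_ , _ ∷ straddle , linked , _ ∷ unique , _ , inc) =
  refl , straddle , Linked.tail linked , unique , inc

SamePattern-tail : {x y : Fin N} (xs ys : List (Fin N)) → SamePattern (x ∷ xs) (y ∷ ys) → SamePattern xs ys
SamePattern-tail []          _       _ = tt
SamePattern-tail (_ ∷ [])    []      _ = tt
SamePattern-tail (_ ∷ _ ∷ _) []      _ = tt
SamePattern-tail (_ ∷ _)     (_ ∷ _) (_ , same-pattern) = same-pattern

equivalent-chains-Separate : (c : OneLine N) (ts₁ ts₂ : List (Fin N × Fin N)) → Distinct c →
  PieriChain k m₁ c ts₁ → PieriChain k m₂ c ts₂ →
  map proj₂ ts₁ ≡ map proj₂ ts₂ → SamePattern (map proj₁ ts₁) (map proj₁ ts₂) →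
  applyTs c ts₁ ≢ applyTs c ts₂ →
  Separates k (applyTs c ts₁) (applyTs c ts₂) ⊎ Separates k (applyTs c ts₂) (applyTs c ts₁)
equivalent-chains-Separate c [] [] _ _ _ _ _ u₁≢u₂ = ⊥-elim (u₁≢u₂ refl)
equivalent-chains-Separate c ((a₁ , b) ∷ ts₁) ((a₂ , _) ∷ ts₂) c-distinct chain₁ chain₂
                           bs≡ same-pattern u₁≢u₂
  with ∷-injective bs≡
... | refl , ds≡ with <ᶠ-cmp a₁ a₂
... | tri≈ _ refl _ = equivalent-chains-Separate (swapPos c a₁ b) ts₁ ts₂ (swapPos-Distinct c a₁ b c-distinct)
  (PieriChain-tail chain₁) (PieriChain-tail chain₂) ds≡
  (SamePattern-tail (map proj₁ ts₁) (map proj₁ ts₂) same-pattern) u₁≢u₂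
... | tri< a₁<a₂ _ _ = inj₁ (first-difference-Separates c ts₁ ts₂ c-distinct chain₁ chain₂ a₁<a₂
  (first-values-agree c a₁ a₂ b ts₁ ts₂ chain₁ chain₂ ds≡ same-pattern))
... | tri> _ _ a₂<a₁ = inj₂ (first-difference-Separates c ts₂ ts₁ c-distinct chain₂ chain₁ a₂<a₁
  (sym (first-values-agree c a₁ a₂ b ts₁ ts₂ chain₁ chain₂ ds≡ same-pattern)))

lemma2p8 : (N k m₁ m₂ : ℕ) → 1 ≤ k → 1 ≤ m₁ → 1 ≤ m₂ →
    (w u₁ u₂ : OneLine N) → IsPerm w →
    PieriTerm k m₁ w u₁ → PieriTerm k m₁ w u₂ →
    Equivalent k m₁ w u₁ u₂ → u₁ ≢ u₂ →
    (u′ : OneLine N) → ¬ (PieriTerm k m₂ u₁ u′ × PieriTerm k m₂ u₂ u′)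
lemma2p8 _ _ _ _ _ _ _ w u₁ u₂ w-perm _ _
         (ts₁ , ts₂ , chain₁ , refl , chain₂ , refl , bs≡ , _ , _ , same-pattern) u₁≢u₂ _ (u₁⇝u′ , u₂⇝u′) =
  [ (λ u₁-sep-u₂ → Separates⇒¬common-term u₁-distinct u₂-distinct u₁-sep-u₂ u₁⇝u′ u₂⇝u′)
  , (λ u₂-sep-u₁ → Separates⇒¬common-term u₂-distinct u₁-distinct u₂-sep-u₁ u₂⇝u′ u₁⇝u′)
  ]′ (equivalent-chains-Separate w ts₁ ts₂ w-distinct chain₁ chain₂ bs≡ same-pattern u₁≢u₂)
  where
  w-distinct : Distinct w
  w-distinct = IsPerm⇒Distinct w w-perm
  u₁-distinct : Distinct u₁
  u₁-distinct = applyTs-Distinct w ts₁ w-distinct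
  u₂-distinct : Distinct u₂
  u₂-distinct = applyTs-Distinct w ts₂ w-distinct
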